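{- Let $\mathcal B\subseteq\mathcal P([n])$ be a simply rooted family. Then (1) for every $B\in\mathcal B$ and $1\le k\le n$, if $D_{(\mathcal B,k)}(B)\neq B$ then $\mathcal P(D_{(\mathcal B,k)}(B))\subseteq D_k(\mathcal B)$; (2) for every $B\in\mathcal B$, $|B\setminus d_{\mathcal B}(B)|\le 1$.
   Context: $\mathcal B$ is simply rooted if for every nonempty $B\in\mathcal B$ there is $b\in B$ with $\{C:\{b\}\subseteq C\subseteq B\}\subseteq\mathcal B$. For $\mathcal F\subseteq\mathcal P([n])$ and $i\in[n]$, define for $F\in\mathcal F$: $d_{(i,\mathcal F)}(F)=F\setminus\{i\}$ if $i\in F$ and $F\setminus\{i\}\notin\mathcal F$, and $d_{(i,\mathcal F)}(F)=F$ otherwise; $d_i(\mathcal F)=\{d_{(i,\mathcal F)}(F):F\in\mathcal F\}$. Set $D_0(\mathcal B)=\mathcal B$ and $D_k(\mathcal B)=d_k(D_{k-1}(\mathcal B))$ for $1\le k\le n$, and $d(\mathcal B)=D_n(\mathcal B)$. For $B\in\mathcal B$, $D_{(\mathcal B,0)}(B)=B$, $D_{(\mathcal B,k)}(B)=d_{(k,D_{k-1}(\mathcal B))}(D_{(\mathcal B,k-1)}(B))$, and $d_{\mathcal B}(B)=D_{(\mathcal B,n)}(B)$. -}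

module Defs where

open import Data.Nat using (ℕ; zero; suc; _<?_)
open import Data.Fin using (Fin; fromℕ<)
open import Data.Fin.Subset using (Subset; _-_; _∈_; _⊆_; ⁅_⁆; Nonempty)
open import Data.Fin.Subset.Properties using (_∈?_)
open import Data.Bool using (Bool) renaming (_≟_ to _≟ᵇ_)
open import Data.Vec.Properties using (≡-dec)
open import Data.List using (List; map)
open import Data.List.Membership.DecPropositional using ()
import Data.List.Membership.Propositional as LM
open import Data.List.Relation.Unary.Any using (any?)
open import Data.Product using (∃; _×_)
open import Relation.Nullary using (Dec; yes; no; ¬_)
open import Relation.Binary.PropositionalEquality using (_≡_)

-- A family of subsets of [n] = Fin n (element k of the paper is position k-1),
-- represented by a finite list; the family is the set of list entries.
Family : ℕ → Set
Family n = List (Subset n)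

infix 4 _∈ᶠ_
_∈ᶠ_ : ∀ {n} → Subset n → Family n → Set
A ∈ᶠ 𝓕 = A LM.∈ 𝓕

_∈ᶠ?_ : ∀ {n} (A : Subset n) (𝓕 : Family n) → Dec (A ∈ᶠ 𝓕)
A ∈ᶠ? 𝓕 = any? (λ B → ≡-dec _≟ᵇ_ A B) 𝓕

SimplyRooted : ∀ {n} → Family n → Set
SimplyRooted {n} 𝓑 =
  ∀ B → B ∈ᶠ 𝓑 → Nonempty B →
    ∃ λ b → b ∈ B × (∀ (C : Subset n) → ⁅ b ⁆ ⊆ C → C ⊆ B → C ∈ᶠ 𝓑)

dElem : ∀ {n} → Fin n → Family n → Subset n → Subset n
dElem i 𝓕 F with i ∈? F | (F - i) ∈ᶠ? 𝓕
... | yes _ | no _ = F - i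
... | _     | _    = F

dFam : ∀ {n} → Fin n → Family n → Family n
dFam i 𝓕 = map (dElem i 𝓕) 𝓕

-- D_k(𝓑) ; step k+1 uses the paper's element k+1, i.e. position k : Fin n.
-- (For k ≥ n the step is the identity; only k ≤ n is ever used.)
DFam : ∀ {n} → Family n → ℕ → Family n
DFam 𝓑 zero = 𝓑
DFam {n} 𝓑 (suc k) with k <? n
... | yes p = dFam (fromℕ< p) (DFam 𝓑 k)
... | no _  = DFam 𝓑 k

DElem : ∀ {n} → Family n → ℕ → Subset n → Subset n
DElem 𝓑 zero B = B
DElem {n} 𝓑 (suc k) B with k <? n
... | yes p = dElem (fromℕ< p) (DFam 𝓑 k) (DElem 𝓑 k B)
... | no _  = DElem 𝓑 k B

dAll : ∀ {n} → Family n → Family n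
dAll {n} 𝓑 = DFam 𝓑 n

d𝓑 : ∀ {n} → Family n → Subset n → Subset n
d𝓑 {n} 𝓑 B = DElem 𝓑 n B

module Submission where

-- Call a member X of a family 𝓕 *rooted* if either the whole
-- power set 𝒫(X) lies in 𝓕 (X is *hereditary* in 𝓕), or X has a root: an
-- element b ∈ X with the interval [{b}, X] contained in 𝓕.  A simply rooted
-- family has all its members rooted (the empty member is hereditary).
--
-- The heart of the proof is a one-step analysis of a single down-shift d_i
-- on a family 𝓕 whose members are all rooted: for X ∈ 𝓕, either
--   * d_i keeps X, and X is again rooted in d_i(𝓕), or
--   * d_i replaces X by X ∖ {i}, and 𝒫(X ∖ {i}) ⊆ d_i(𝓕);
-- moreover hereditary members are kept and stay hereditary.  Consequently
-- d_i preserves "all members rooted", so every D_k(𝓑) has this property, and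
-- following a member B through the shifts D_1, …, D_n we see that its image
-- is either still B, or has lost a single element j and is hereditary from
-- then on.  Both parts of the theorem are read off from this trace.

open import Defs
open import Data.Nat using (ℕ; _≤_; zero; suc; _<?_; z≤n)
open import Data.Nat.Properties using (≤-trans; ≤-reflexive)
open import Data.Fin using (Fin; fromℕ<) renaming (_≟_ to _≟ᶠ_)
open import Data.Fin.Subset
  using (Subset; _⊆_; _─_; ∣_∣; _-_; _∈_; _∉_; ⁅_⁆; _∪_; ⊥; inside; outside)
open import Data.Fin.Subset.Properties
  using ( _∈?_; p─q⊆p; x∈p∧x≢y⇒x∈p-y; x∈⁅x⁆; x∈⁅y⁆⇒x≡y; ⊆-antisym; x∈p∪q⁺; x∈p∪q⁻
        ; Empty-unique; nonempty?; p⊆q⇒∣p∣≤∣q∣; ∣⊥∣≡0; ∣⁅x⁆∣≡1)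
open import Data.Vec using (_∷_; there)
open import Data.List.Membership.Propositional.Properties using (∈-map⁺; ∈-map⁻)
open import Data.Product using (_×_; _,_; ∃; proj₁)
open import Data.Sum using (_⊎_; inj₁; inj₂)
open import Data.Empty using (⊥-elim)
open import Relation.Nullary using (Dec; yes; no; ¬_)
open import Relation.Binary.PropositionalEquality
  using (_≢_; _≡_; refl; sym; trans; subst)

private variable
  n : ℕ

x∈p─q⇒x∉q : (p q : Subset n) {x : Fin n} → x ∈ p ─ q → x ∉ q
x∈p─q⇒x∉q (_ ∷ p) (inside  ∷ q) (there x∈) (there x∈q) = x∈p─q⇒x∉q p q x∈ x∈q
x∈p─q⇒x∉q (_ ∷ p) (outside ∷ q) (there x∈) (there x∈q) = x∈p─q⇒x∉q p q x∈ x∈q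

x∈p-i⇒x∈p : {p : Subset n} {i x : Fin n} → x ∈ p - i → x ∈ p
x∈p-i⇒x∈p {p = p} {i} = p─q⊆p p ⁅ i ⁆

x∈p-i⇒x≢i : {p : Subset n} {i x : Fin n} → x ∈ p - i → x ≢ i
x∈p-i⇒x≢i {p = p} {i} x∈ refl = x∈p─q⇒x∉q p ⁅ i ⁆ x∈ (x∈⁅x⁆ i)

⊆p-i⇒i∉ : {p Z : Subset n} {i : Fin n} → Z ⊆ p - i → i ∉ Z
⊆p-i⇒i∉ Z⊆ i∈Z = x∈p-i⇒x≢i (Z⊆ i∈Z) refl

⊆-i : {p q : Subset n} {i : Fin n} → p ⊆ q → p - i ⊆ q - i
⊆-i p⊆q x∈ = x∈p∧x≢y⇒x∈p-y (p⊆q (x∈p-i⇒x∈p x∈)) (x∈p-i⇒x≢i x∈)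

⊆-avoiding : {p q : Subset n} {i : Fin n} → i ∉ p → p ⊆ q → p ⊆ q - i
⊆-avoiding i∉p p⊆q {x} x∈ = x∈p∧x≢y⇒x∈p-y (p⊆q x∈) (λ { refl → i∉p x∈ })

[p∪i]-i≡p : {p : Subset n} {i : Fin n} → i ∉ p → (p ∪ ⁅ i ⁆) - i ≡ p
[p∪i]-i≡p {p = p} {i} i∉p = ⊆-antisym back (⊆-avoiding i∉p (λ x∈ → x∈p∪q⁺ (inj₁ x∈)))
  where
  back : (p ∪ ⁅ i ⁆) - i ⊆ p
  back x∈ with x∈p∪q⁻ p ⁅ i ⁆ (x∈p-i⇒x∈p x∈)
  ... | inj₁ x∈p = x∈p
  ... | inj₂ x∈i = ⊥-elim (x∈p-i⇒x≢i x∈ (x∈⁅y⁆⇒x≡y i x∈i))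

p─[p-i]⊆⁅i⁆ : (p : Subset n) (i : Fin n) → p ─ (p - i) ⊆ ⁅ i ⁆
p─[p-i]⊆⁅i⁆ p i {x} x∈ with x ≟ᶠ i
... | yes refl = x∈⁅x⁆ i
... | no  x≢i  = ⊥-elim (x∈p─q⇒x∉q p (p - i) x∈ (x∈p∧x≢y⇒x∈p-y (p─q⊆p p _ x∈) x≢i))

p─p⊆⊥ : (p : Subset n) → p ─ p ⊆ ⊥
p─p⊆⊥ p x∈ = ⊥-elim (x∈p─q⇒x∉q p p x∈ (p─q⊆p p p x∈))

⁅⁆⊆ : {b : Fin n} {C : Subset n} → b ∈ C → ⁅ b ⁆ ⊆ C
⁅⁆⊆ {b = b} {C} b∈C x∈ = subst (_∈ C) (sym (x∈⁅y⁆⇒x≡y b x∈)) b∈C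

Hereditary : Family n → Subset n → Set
Hereditary 𝓕 X = ∀ Z → Z ⊆ X → Z ∈ᶠ 𝓕

RootOf : Family n → Fin n → Subset n → Set
RootOf {n} 𝓕 b X = b ∈ X × (∀ (C : Subset n) → ⁅ b ⁆ ⊆ C → C ⊆ X → C ∈ᶠ 𝓕)

Rooted : Family n → Subset n → Set
Rooted 𝓕 X = Hereditary 𝓕 X ⊎ ∃ λ b → RootOf 𝓕 b X

AllRooted : Family n → Set
AllRooted 𝓕 = ∀ X → X ∈ᶠ 𝓕 → Rooted 𝓕 X

-- Tracing an original set B through the shifts: its current image X in 𝓕 is
-- either B itself, or B minus at most one element j, with X hereditary in 𝓕.
Trace : Family n → Subset n → Subset n → Set
Trace 𝓕 B X = X ≡ B ⊎ ∃ λ j → B ─ X ⊆ ⁅ j ⁆ × Hereditary 𝓕 X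

trace-loses-≤1 : {𝓕 : Family n} {B X : Subset n} → Trace 𝓕 B X → ∣ B ─ X ∣ ≤ 1
trace-loses-≤1 {n} {B = B} (inj₁ refl) =
  ≤-trans (p⊆q⇒∣p∣≤∣q∣ (p─p⊆⊥ B)) (subst (_≤ 1) (sym (∣⊥∣≡0 n)) z≤n)
trace-loses-≤1 (inj₂ (j , lost , _)) = ≤-trans (p⊆q⇒∣p∣≤∣q∣ lost) (≤-reflexive (∣⁅x⁆∣≡1 j))

simplyRooted⇒allRooted : (𝓑 : Family n) → SimplyRooted 𝓑 → AllRooted 𝓑
simplyRooted⇒allRooted 𝓑 sr X X∈ with nonempty? X
... | yes ne = let (b , b∈X , interval) = sr X X∈ ne in inj₂ (b , b∈X , interval)
... | no  X-empty = inj₁ λ Z Z⊆X →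
  let Z-empty = λ ((x , x∈Z) : ∃ (_∈ Z)) → X-empty (x , Z⊆X x∈Z)
  in subst (_∈ᶠ 𝓑) (trans (Empty-unique X-empty) (sym (Empty-unique Z-empty))) X∈

dElem-keep : (i : Fin n) (𝓕 : Family n) (C : Subset n) →
             (i ∈ C → (C - i) ∈ᶠ 𝓕) → dElem i 𝓕 C ≡ C
dElem-keep i 𝓕 C C-i∈ with i ∈? C | (C - i) ∈ᶠ? 𝓕
... | yes i∈C | no  C-i∉ = ⊥-elim (C-i∉ (C-i∈ i∈C))
... | yes _   | yes _    = refl
... | no  _   | _        = refl

dElem-drop : (i : Fin n) (𝓕 : Family n) (C : Subset n) →
             i ∈ C → ¬ (C - i) ∈ᶠ 𝓕 → dElem i 𝓕 C ≡ C - i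
dElem-drop i 𝓕 C i∈C C-i∉ with i ∈? C | (C - i) ∈ᶠ? 𝓕
... | yes _   | no  _    = refl
... | yes _   | yes C-i∈ = ⊥-elim (C-i∉ C-i∈)
... | no  i∉C | _        = ⊥-elim (i∉C i∈C)

module Shift (i : Fin n) (𝓕 : Family n) where

  G : Family n
  G = dFam i 𝓕

  kept∈G : {C : Subset n} → C ∈ᶠ 𝓕 → (i ∈ C → (C - i) ∈ᶠ 𝓕) → C ∈ᶠ G
  kept∈G {C} C∈ C-i∈ = subst (_∈ᶠ G) (dElem-keep i 𝓕 C C-i∈) (∈-map⁺ (dElem i 𝓕) C∈)

  dropped∈G : {C : Subset n} → C ∈ᶠ 𝓕 → i ∈ C → ¬ (C - i) ∈ᶠ 𝓕 → (C - i) ∈ᶠ G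
  dropped∈G {C} C∈ i∈C C-i∉ = subst (_∈ᶠ G) (dElem-drop i 𝓕 C i∈C C-i∉) (∈-map⁺ (dElem i 𝓕) C∈)

  hereditary-kept : {X : Subset n} → Hereditary 𝓕 X → dElem i 𝓕 X ≡ X × Hereditary G X
  hereditary-kept {X} H =
      dElem-keep i 𝓕 X (λ _ → H (X - i) x∈p-i⇒x∈p)
    , λ Z Z⊆X → kept∈G (H Z Z⊆X) (λ _ → H (Z - i) (λ z∈ → Z⊆X (x∈p-i⇒x∈p z∈)))

  root-kept : {b : Fin n} {X : Subset n} → b ≢ i → RootOf 𝓕 b X →
              dElem i 𝓕 X ≡ X × RootOf G b X
  root-kept {b} {X} b≢i (b∈X , interval) =
      dElem-keep i 𝓕 X (λ _ → interval (X - i) (⁅⁆⊆ (x∈p∧x≢y⇒x∈p-y b∈X b≢i)) x∈p-i⇒x∈p)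
    , b∈X
    , λ C b⊆C C⊆X → kept∈G (interval C b⊆C C⊆X)
        (λ _ → interval (C - i) (⁅⁆⊆ (x∈p∧x≢y⇒x∈p-y (b⊆C (x∈⁅x⁆ b)) b≢i)) (λ c∈ → C⊆X (x∈p-i⇒x∈p c∈)))

  -- If i is a root of X and X - i ∉ 𝓕, then 𝒫(X - i) ⊆ G: a subset Z of
  -- X - i is either kept itself, or is the image of Z ∪ {i} ∈ [{i}, X].
  root-dropped : {X : Subset n} → RootOf 𝓕 i X → ¬ (X - i) ∈ᶠ 𝓕 → Hereditary G (X - i)
  root-dropped {X} (i∈X , interval) X-i∉ Z Z⊆ with Z ∈ᶠ? 𝓕
  ... | yes Z∈ = kept∈G Z∈ (λ i∈Z → ⊥-elim (⊆p-i⇒i∉ Z⊆ i∈Z))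
  ... | no  Z∉ = subst (_∈ᶠ G) ([p∪i]-i≡p i∉Z)
                   (dropped∈G Z+i∈ (x∈p∪q⁺ (inj₂ (x∈⁅x⁆ i)))
                      (λ Z+i-i∈ → Z∉ (subst (_∈ᶠ 𝓕) ([p∪i]-i≡p i∉Z) Z+i-i∈)))
    where
    i∉Z : i ∉ Z
    i∉Z = ⊆p-i⇒i∉ Z⊆
    Z+i⊆X : Z ∪ ⁅ i ⁆ ⊆ X
    Z+i⊆X x∈ with x∈p∪q⁻ Z ⁅ i ⁆ x∈
    ... | inj₁ x∈Z = x∈p-i⇒x∈p (Z⊆ x∈Z)
    ... | inj₂ x∈i = ⁅⁆⊆ i∈X x∈i
    Z+i∈ : (Z ∪ ⁅ i ⁆) ∈ᶠ 𝓕
    Z+i∈ = interval (Z ∪ ⁅ i ⁆) (λ x∈ → x∈p∪q⁺ (inj₂ x∈)) Z+i⊆X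

  root-kept-hereditary : {X : Subset n} → RootOf 𝓕 i X → Hereditary 𝓕 (X - i) → Hereditary G X
  root-kept-hereditary {X} (_ , interval) H Z Z⊆X with i ∈? Z
  ... | yes i∈Z = kept∈G (interval Z (⁅⁆⊆ i∈Z) Z⊆X) (λ _ → H (Z - i) (⊆-i Z⊆X))
  ... | no  i∉Z = kept∈G (H Z (⊆-avoiding i∉Z Z⊆X)) (λ i∈Z → ⊥-elim (i∉Z i∈Z))

  root-kept-rerooted : {X : Subset n} {b : Fin n} → RootOf 𝓕 i X → RootOf 𝓕 b (X - i) → RootOf G b X
  root-kept-rerooted {X} {b} (_ , interval) (b∈X-i , interval′) =
      x∈p-i⇒x∈p b∈X-i , intervalG
    where
    b≢i : b ≢ i
    b≢i = x∈p-i⇒x≢i b∈X-i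
    intervalG : ∀ C → ⁅ b ⁆ ⊆ C → C ⊆ X → C ∈ᶠ G
    intervalG C b⊆C C⊆X with i ∈? C
    ... | yes i∈C = kept∈G (interval C (⁅⁆⊆ i∈C) C⊆X)
                      (λ _ → interval′ (C - i) (⁅⁆⊆ (x∈p∧x≢y⇒x∈p-y (b⊆C (x∈⁅x⁆ b)) b≢i)) (⊆-i C⊆X))
    ... | no  i∉C = kept∈G (interval′ C b⊆C (⊆-avoiding i∉C C⊆X)) (λ i∈C → ⊥-elim (i∉C i∈C))

  ShiftOutcome : Subset n → Set
  ShiftOutcome X = (dElem i 𝓕 X ≡ X × Rooted G X)
                 ⊎ (dElem i 𝓕 X ≡ X - i × Hereditary G (X - i))

  root-i-outcome : AllRooted 𝓕 → {X : Subset n} → RootOf 𝓕 i X → Dec ((X - i) ∈ᶠ 𝓕) → ShiftOutcome X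
  root-i-outcome _ {X} root (no X-i∉) =
    inj₂ (dElem-drop i 𝓕 X (proj₁ root) X-i∉ , root-dropped root X-i∉)
  root-i-outcome rooted {X} root (yes X-i∈) with rooted (X - i) X-i∈
  ... | inj₁ H = inj₁ (dElem-keep i 𝓕 X (λ _ → X-i∈) , inj₁ (root-kept-hereditary root H))
  ... | inj₂ (b , root′) =
        inj₁ (dElem-keep i 𝓕 X (λ _ → X-i∈) , inj₂ (b , root-kept-rerooted root root′))

  shift-outcome : AllRooted 𝓕 → (X : Subset n) → X ∈ᶠ 𝓕 → ShiftOutcome X
  shift-outcome rooted X X∈ with rooted X X∈
  ... | inj₁ H = let (kept , H′) = hereditary-kept H in inj₁ (kept , inj₁ H′)
  ... | inj₂ (b , root) with b ≟ᶠ i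
  ...   | no b≢i   = let (kept , root′) = root-kept b≢i root in inj₁ (kept , inj₂ (b , root′))
  ...   | yes refl = root-i-outcome rooted root ((X - i) ∈ᶠ? 𝓕)

  allRooted-shift : AllRooted 𝓕 → AllRooted G
  allRooted-shift rooted Y Y∈G with ∈-map⁻ (dElem i 𝓕) Y∈G
  ... | X , X∈ , refl with shift-outcome rooted X X∈
  ...   | inj₁ (kept , R) = subst (Rooted G) (sym kept) R
  ...   | inj₂ (dropped , H) = subst (Rooted G) (sym dropped) (inj₁ H)

  -- A traced set stays traced: a hereditary image is kept, and an unchanged
  -- image B either stays B or loses exactly i.
  trace-shift : AllRooted 𝓕 → {B X : Subset n} → X ∈ᶠ 𝓕 → Trace 𝓕 B X → Trace G B (dElem i 𝓕 X)
  trace-shift _ _ (inj₂ (j , lost , H)) with hereditary-kept H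
  ... | kept , H′ rewrite kept = inj₂ (j , lost , H′)
  trace-shift rooted {B} X∈ (inj₁ refl) with shift-outcome rooted B X∈
  ... | inj₁ (kept , _)    = inj₁ kept
  ... | inj₂ (dropped , H) rewrite dropped = inj₂ (i , p─[p-i]⊆⁅i⁆ B i , H)

module Iterate (𝓑 : Family n) (sr : SimplyRooted 𝓑) where

  allRooted-D : ∀ k → AllRooted (DFam 𝓑 k)
  allRooted-D zero = simplyRooted⇒allRooted 𝓑 sr
  allRooted-D (suc k) with k <? n
  ... | yes k<n = Shift.allRooted-shift (fromℕ< k<n) (DFam 𝓑 k) (allRooted-D k)
  ... | no  _   = allRooted-D k

  DElem∈DFam : ∀ {B} → B ∈ᶠ 𝓑 → ∀ k → DElem 𝓑 k B ∈ᶠ DFam 𝓑 k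
  DElem∈DFam B∈ zero = B∈
  DElem∈DFam B∈ (suc k) with k <? n
  ... | yes k<n = ∈-map⁺ (dElem (fromℕ< k<n) (DFam 𝓑 k)) (DElem∈DFam B∈ k)
  ... | no  _   = DElem∈DFam B∈ k

  trace : ∀ {B} → B ∈ᶠ 𝓑 → ∀ k → Trace (DFam 𝓑 k) B (DElem 𝓑 k B)
  trace B∈ zero = inj₁ refl
  trace B∈ (suc k) with k <? n
  ... | yes k<n = Shift.trace-shift (fromℕ< k<n) (DFam 𝓑 k) (allRooted-D k) (DElem∈DFam B∈ k) (trace B∈ k)
  ... | no  _   = trace B∈ k

lemma10 : ∀ (n : ℕ) (𝓑 : Family n) → SimplyRooted 𝓑 →
    (∀ B → B ∈ᶠ 𝓑 → ∀ (k : ℕ) → 1 ≤ k → k ≤ n → DElem 𝓑 k B ≢ B →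
        ∀ (C : Subset n) → C ⊆ DElem 𝓑 k B → C ∈ᶠ DFam 𝓑 k)
    × (∀ B → B ∈ᶠ 𝓑 → ∣ B ─ d𝓑 𝓑 B ∣ ≤ 1)
lemma10 n 𝓑 sr = changed⇒hereditary , (λ B B∈ → trace-loses-≤1 (trace B∈ n))
  where
  open Iterate 𝓑 sr

  -- (1): a set moved by the first k shifts is hereditary in D_k(𝓑).
  changed⇒hereditary : ∀ B → B ∈ᶠ 𝓑 → ∀ (k : ℕ) → 1 ≤ k → k ≤ n → DElem 𝓑 k B ≢ B →
                       ∀ (C : Subset n) → C ⊆ DElem 𝓑 k B → C ∈ᶠ DFam 𝓑 k
  changed⇒hereditary B B∈ k _ _ changed with trace B∈ k
  ... | inj₁ unchanged   = ⊥-elim (changed unchanged)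
  ... | inj₂ (_ , _ , H) = H
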